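{- Let $G$ be a 2-connected closed claw-free graph on $n$ vertices. If there are two nonadjacent vertices $u,v\in V(G)$ with $d(u)+d(v)\geq n$, then $G$ is Hamiltonian.
   Context: All graphs are finite and simple; claw-free means no induced $K_{1,3}$. In a claw-free graph $G$, a vertex $x$ is eligible if its neighborhood $N(x)$ induces a connected but not complete subgraph. The local completion of $G$ at an eligible vertex $x$ is obtained by adding all edges $uv$ with $u,v\in N(x)$, $uv\notin E(G)$. The (Ryjáček) closure $cl(G)$ is obtained by repeatedly performing local completions at eligible vertices until no eligible vertex remains (it is well defined). $G$ is closed if $cl(G)=G$, i.e., $G$ has no eligible vertex. -}

module Defs where

open import Data.Nat using (ℕ; zero; suc; _+_; _≤_)
open import Data.Fin using (Fin; toℕ)
open import Data.Bool using (Bool; true; false; if_then_else_)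
open import Data.List using (List; map; allFin)
open import Data.Nat.ListAction using (sum)
open import Data.Unit using (⊤)
open import Data.Product using (Σ; _×_; _,_; ∃-syntax)
open import Relation.Binary.PropositionalEquality using (_≡_; _≢_)
open import Relation.Nullary using (¬_)
open import Function.Definitions using (Injective)

record Graph (n : ℕ) : Set where
  field
    adj    : Fin n → Fin n → Bool
    sym    : ∀ u v → adj u v ≡ adj v u
    irrefl : ∀ v → adj v v ≡ false

module _ {n : ℕ} (G : Graph n) where
  open Graph G

  Adj : Fin n → Fin n → Set
  Adj u v = adj u v ≡ true

  deg : Fin n → ℕ
  deg v = sum (map (λ w → if adj v w then 1 else 0) (allFin n))

  data WalkIn (S : Fin n → Set) : Fin n → Fin n → Set where
    here : ∀ {u} → S u → WalkIn S u u
    step : ∀ {u w v} → S u → Adj u w → WalkIn S w v → WalkIn S u v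

  ConnectedOn : (Fin n → Set) → Set
  ConnectedOn S = ∀ u v → S u → S v → WalkIn S u v

  CompleteOn : (Fin n → Set) → Set
  CompleteOn S = ∀ u v → S u → S v → u ≢ v → Adj u v

  Connected : Set
  Connected = ConnectedOn (λ _ → ⊤)

  TwoConnected : Set
  TwoConnected = (3 ≤ n) × Connected × (∀ x → ConnectedOn (λ y → y ≢ x))

  ClawFree : Set
  ClawFree = ∀ c a b d → Adj c a → Adj c b → Adj c d →
             a ≢ b → a ≢ d → b ≢ d →
             ¬ (¬ Adj a b × ¬ Adj a d × ¬ Adj b d)

  Eligible : Fin n → Set
  Eligible x = ConnectedOn (Adj x) × ¬ CompleteOn (Adj x)

  -- closed (in the sense of Ryjáček's closure): no eligible vertex
  Closed : Set
  Closed = ∀ x → ¬ Eligible x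

  -- Hamiltonian: a cycle through all n ≥ 3 vertices, given as an
  -- injective (hence bijective) cyclic ordering f : Fin n → Fin n
  Hamiltonian : Set
  Hamiltonian = (3 ≤ n) × Σ (Fin n → Fin n) λ f → Injective _≡_ _≡_ f ×
    (∀ i j → toℕ j ≡ suc (toℕ i) → Adj (f i) (f j)) ×
    (∀ i j → toℕ i ≡ 0 → suc (toℕ j) ≡ n → Adj (f j) (f i))

-- Let Z be the set of vertices adjacent to neither u nor v (so u, v ∈ Z) and T the set
-- of common neighbours of u and v.  Inclusion–exclusion gives
--   d(u) + d(v) + |Z| = n + |T|,   hence  |Z| ≤ |T|.
-- In a closed claw-free graph the common neighbours of u and v are pairwise nonadjacent
-- (a common neighbour adjacent to another one would make the neighbourhood of the latter
-- connected, i.e. eligible), so claw-freeness at u gives |T| ≤ 2.  Therefore Z = {u, v}: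
-- every other vertex is adjacent to u or v, and u, v have exactly two common neighbours
-- w₁, w₂, which are nonadjacent.  Each of the four sets N(u)∩N(w₁), N(v)∩N(w₁),
-- N(v)∩N(w₂), N(u)∩N(w₂) is a clique, and together with u, w₁, v, w₂ they cover the
-- graph, so
--   u → N(u)∩N(w₁) → w₁ → N(v)∩N(w₁) → v → N(v)∩N(w₂) → w₂ → N(u)∩N(w₂) → u
-- is a Hamiltonian cycle.
module Submission where

open import Defs
open import Data.Nat using (ℕ; suc; pred; _+_; _≤_; s≤s)
open import Data.Nat.Properties using (≤-antisym; ≤-trans; ≤-reflexive; +-cancelˡ-≤; +-monoˡ-≤; n≤1+n; n≮n; 0≢1+n; module ≤-Reasoning)
open import Data.Nat.Tactic.RingSolver using (solve-∀)
open import Data.Nat.ListAction using (sum)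
import Data.Fin as F
open import Data.Fin using (Fin; toℕ; cast)
open import Data.Fin.Properties using (_≟_; injective⇒≤; toℕ-cast; toℕ-injective)
open import Data.Bool using (Bool; true; false; not; _∧_; _∨_; if_then_else_; T)
import Data.Bool as Bool
open import Data.Bool.Properties using (T-∧; T-≡; ¬-not)
open import Data.List using (List; []; _∷_; _++_; length; lookup; map; filter; allFin)
open import Data.List.Properties using (length-tabulate)
open import Data.List.Membership.Propositional using (_∈_)
open import Data.List.Membership.Propositional.Properties using (∈-lookup; ∈-filter⁺; ∈-filter⁻; ∈-allFin; ∈-++⁺ˡ; ∈-++⁺ʳ)
open import Data.List.Relation.Unary.Any as Any using (here; there)
open import Data.List.Relation.Unary.Any.Properties using (lookup-index)
open import Data.List.Relation.Unary.All as All using (All; []; _∷_)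
import Data.List.Relation.Unary.All.Properties as AllP
open import Data.List.Relation.Unary.AllPairs using ([]; _∷_)
open import Data.List.Relation.Unary.Unique.Propositional using (Unique)
import Data.List.Relation.Unary.Unique.Propositional.Properties as Unique
open import Data.Empty using (⊥; ⊥-elim)
open import Data.Product using (_×_; _,_; ∃-syntax; proj₁; proj₂)
open import Data.Sum using (_⊎_; inj₁; inj₂)
open import Function using (_∘_)
open import Function.Bundles using (Equivalence)
open import Function.Definitions using (Injective)
open import Relation.Nullary using (¬_; Dec; yes; no; does)
open import Relation.Nullary.Decidable using (T?; dec-true; dec-false)
open import Relation.Binary.PropositionalEquality using (_≡_; _≢_; refl; sym; trans; cong; cong₂; module ≡-Reasoning)

open Equivalence using (to)

lookup-injective : ∀ {A : Set} {xs : List A} → Unique xs → ∀ i j → lookup xs i ≡ lookup xs j → i ≡ j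
lookup-injective (_ ∷ _) F.zero F.zero _ = refl
lookup-injective (x∉xs ∷ _) F.zero (F.suc j) e = ⊥-elim (All.lookup x∉xs (∈-lookup j) e)
lookup-injective (x∉xs ∷ _) (F.suc i) F.zero e = ⊥-elim (All.lookup x∉xs (∈-lookup i) (sym e))
lookup-injective (_ ∷ uniq) (F.suc i) (F.suc j) e = cong F.suc (lookup-injective uniq i j e)

unique-length-≤ : ∀ {A : Set} {xs ys : List A} → Unique xs → All (_∈ ys) xs → length xs ≤ length ys
unique-length-≤ {xs = xs} {ys} uniq sub = injective⇒≤ position-injective
  where
  position : Fin (length xs) → Fin (length ys)
  position i = Any.index (All.lookup sub (∈-lookup i))
  position-correct : ∀ i → lookup xs i ≡ lookup ys (position i)
  position-correct i = lookup-index (All.lookup sub (∈-lookup i))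
  position-injective : Injective _≡_ _≡_ position
  position-injective {i} {j} e = lookup-injective uniq i j
    (trans (position-correct i) (trans (cong (lookup ys) e) (sym (position-correct j))))

two-distinct : ∀ {A : Set} (ys : List A) → Unique ys → 2 ≤ length ys →
  ∃[ a ] ∃[ b ] (a ∈ ys × b ∈ ys × a ≢ b)
two-distinct (x ∷ y ∷ _) ((x≢y ∷ _) ∷ _) _ = x , y , here refl , there (here refl) , x≢y
two-distinct (_ ∷ []) _ (s≤s ())

three-distinct : ∀ {A : Set} (ys : List A) → Unique ys → 3 ≤ length ys →
  ∃[ a ] ∃[ b ] ∃[ c ] (a ∈ ys × b ∈ ys × c ∈ ys × a ≢ b × a ≢ c × b ≢ c)
three-distinct (x ∷ y ∷ z ∷ _) ((x≢y ∷ x≢z ∷ _) ∷ (y≢z ∷ _) ∷ _) _ =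
  x , y , z , here refl , there (here refl) , there (there (here refl)) , x≢y , x≢z , y≢z
three-distinct (_ ∷ _ ∷ []) _ (s≤s (s≤s ()))
three-distinct (_ ∷ []) _ (s≤s ())

data Chain {A : Set} (R : A → A → Set) : A → List A → A → Set where
  done : ∀ {a b} → R a b → Chain R a [] b
  link : ∀ {a x xs b} → R a x → Chain R x xs b → Chain R a (x ∷ xs) b

chain-++ : ∀ {A : Set} {R : A → A → Set} {a b c xs ys} →
  Chain R a xs b → Chain R b ys c → Chain R a (xs ++ b ∷ ys) c
chain-++ (done ab) c = link ab c
chain-++ (link ax c) c' = link ax (chain-++ c c')

chain-consecutive : ∀ {A : Set} {R : A → A → Set} {a xs b} → Chain R a xs b →
  ∀ (i j : Fin (suc (length xs))) → toℕ j ≡ suc (toℕ i) → R (lookup (a ∷ xs) i) (lookup (a ∷ xs) j)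
chain-consecutive (link ax _) F.zero (F.suc F.zero) _ = ax
chain-consecutive (link _ c) (F.suc i) (F.suc j) e = chain-consecutive c i j (cong pred e)

chain-closing : ∀ {A : Set} {R : A → A → Set} {a xs b} → Chain R a xs b →
  ∀ (j : Fin (suc (length xs))) → suc (toℕ j) ≡ suc (length xs) → R (lookup (a ∷ xs) j) b
chain-closing (done ab) F.zero _ = ab
chain-closing (link _ c) (F.suc j) e = chain-closing c j (cong pred e)

clique-chain : ∀ {A : Set} {R : A → A → Set} (P : A → Set) {a b} (xs : List A) → Unique xs →
  All P xs → (∀ {x y} → P x → P y → x ≢ y → R x y) →
  All (R a) xs → (∀ {x} → P x → R x b) → R a b → Chain R a xs b
clique-chain P [] _ _ _ _ _ ab = done ab
clique-chain P (x ∷ xs) (x∉xs ∷ uniq) (px ∷ pxs) clique (ax ∷ _) toB _ =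
  link ax (clique-chain P xs uniq pxs clique
    (All.zipWith (λ (py , x≢y) → clique px py x≢y) (pxs , x∉xs)) toB (toB px))

module _ {A : Set} (rank : A → ℕ) where
  RankedFrom : ℕ → List A → Set
  RankedFrom k xs = Unique xs × All (λ y → k ≤ rank y) xs

  prepend-block : ∀ {k s r} → Unique s → All (λ y → rank y ≡ k) s → RankedFrom (suc k) r →
    RankedFrom k (s ++ r)
  prepend-block {k} uniq-s rank-s (uniq-r , rank-r) =
    Unique.++⁺ uniq-s uniq-r
      (λ (m-s , m-r) → n≮n k (≤-trans (All.lookup rank-r m-r) (≤-reflexive (All.lookup rank-s m-s)))) ,
    AllP.++⁺ (All.map (≤-reflexive ∘ sym) rank-s) (All.map (≤-trans (n≤1+n k)) rank-r)

count : ∀ {A : Set} → (A → Bool) → List A → ℕ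
count p xs = sum (map (λ w → if p w then 1 else 0) xs)

select : ∀ {A : Set} → (A → Bool) → List A → List A
select p = filter (λ w → T? (p w))

-- Arithmetic of inclusion–exclusion: one more entry contributes p, q, r to the three
-- counts on the left and 1, s to the two on the right.
add-entry : ∀ p q r s → p + q + r ≡ suc s → ∀ a c z l t → a + c + z ≡ l + t →
  (p + a) + (q + c) + (r + z) ≡ suc (l + (s + t))
add-entry p q r s new a c z l t old = begin
  (p + a) + (q + c) + (r + z) ≡⟨ regroup p q r a c z ⟩
  (p + q + r) + (a + c + z)   ≡⟨ cong₂ _+_ new old ⟩
  suc s + (l + t)             ≡⟨ cong suc (swap s l t) ⟩
  suc (l + (s + t))           ∎
  where
  open ≡-Reasoning
  regroup : ∀ p q r a c z → (p + a) + (q + c) + (r + z) ≡ (p + q + r) + (a + c + z)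
  regroup = solve-∀
  swap : ∀ s l t → s + (l + t) ≡ l + (s + t)
  swap = solve-∀

module _ {A : Set} (f g : A → Bool) where
  neither-count both-count : List A → ℕ
  neither-count xs = length (select (λ w → not (f w ∨ g w)) xs)
  both-count xs = length (select (λ w → f w ∧ g w) xs)

  extend : ∀ p q r s → p + q + r ≡ suc s → ∀ xs →
    count f xs + count g xs + neither-count xs ≡ length xs + both-count xs →
    (p + count f xs) + (q + count g xs) + (r + neither-count xs) ≡ suc (length xs + (s + both-count xs))
  extend p q r s new xs = add-entry p q r s new (count f xs) (count g xs) (neither-count xs) (length xs) (both-count xs)

  inclusion-exclusion : ∀ xs → count f xs + count g xs + neither-count xs ≡ length xs + both-count xs
  inclusion-exclusion [] = refl
  inclusion-exclusion (x ∷ xs) with f x | g x | inclusion-exclusion xs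
  ... | true  | true  | ih = extend 1 1 0 1 refl xs ih
  ... | true  | false | ih = extend 1 0 0 0 refl xs ih
  ... | false | true  | ih = extend 0 1 0 0 refl xs ih
  ... | false | false | ih = extend 0 0 1 0 refl xs ih

module Adjacency {n : ℕ} (G : Graph n) where
  open Graph G using (adj; irrefl) renaming (sym to adj-sym)

  infix 4 _~_
  _~_ : Fin n → Fin n → Set
  a ~ b = Adj G a b

  ~-sym : ∀ {a b} → a ~ b → b ~ a
  ~-sym {a} {b} e = trans (adj-sym b a) e

  ~-irrefl : ∀ {a} → ¬ a ~ a
  ~-irrefl {a} e with trans (sym (irrefl a)) e
  ... | ()

  ~⇒≢ : ∀ {a b} → a ~ b → a ≢ b
  ~⇒≢ e refl = ~-irrefl e

  ~⇒≢˘ : ∀ {a b} → a ~ b → b ≢ a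
  ~⇒≢˘ e refl = ~-irrefl e

  ~-≁-≢ : ∀ {a x y} → a ~ x → ¬ a ~ y → x ≢ y
  ~-≁-≢ ax a≁y refl = a≁y ax

  _~?_ : ∀ a b → Dec (a ~ b)
  a ~? b = adj a b Bool.≟ true

  ≁⇒false : ∀ {a b} → ¬ a ~ b → adj a b ≡ false
  ≁⇒false = ¬-not

  common : Fin n → Fin n → List (Fin n)
  common a b = select (λ w → adj a w ∧ adj b w) (allFin n)

  common⁻ : ∀ {a b x} → x ∈ common a b → a ~ x × b ~ x
  common⁻ {a} {b} {x} m with to T-∧ (proj₂ (∈-filter⁻ (λ w → T? (adj a w ∧ adj b w)) {xs = allFin n} m))
  ... | ta , tb = to T-≡ ta , to T-≡ tb

  common⁺ : ∀ {a b x} → a ~ x → b ~ x → x ∈ common a b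
  common⁺ {a} {b} {x} ax bx = ∈-filter⁺ (λ w → T? (adj a w ∧ adj b w)) (∈-allFin x) (both ax bx)
    where
    both : ∀ {p q} → p ≡ true → q ≡ true → T (p ∧ q)
    both refl refl = _

  common-unique : ∀ a b → Unique (common a b)
  common-unique a b = Unique.filter⁺ (λ w → T? (adj a w ∧ adj b w)) (Unique.allFin⁺ n)

  common-all : ∀ {a b} → All (λ x → a ~ x × b ~ x) (common a b)
  common-all = All.tabulate common⁻

  walk-++ : ∀ {S a b c} → WalkIn G S a b → WalkIn G S b c → WalkIn G S a c
  walk-++ (here _) w = w
  walk-++ (step sa e w) w' = step sa e (walk-++ w w')

  walk-snoc : ∀ {S a b c} → WalkIn G S a b → b ~ c → S c → WalkIn G S a c
  walk-snoc (here sb) bc sc = step sb bc (here sc)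
  walk-snoc (step sa e w) bc sc = step sa e (walk-snoc w bc sc)

  walk-reverse : ∀ {S a b} → WalkIn G S a b → WalkIn G S b a
  walk-reverse (here sa) = here sa
  walk-reverse (step sa e w) = walk-snoc (walk-reverse w) (~-sym e) sa

  cycle⇒hamiltonian : 3 ≤ n → (u : Fin n) (rest : List (Fin n)) → Unique (u ∷ rest) →
    (∀ x → x ∈ u ∷ rest) → Chain _~_ u rest u → Hamiltonian G
  cycle⇒hamiltonian n≥3 u rest uniq covers chain =
    n≥3 , f , f-injective , f-consecutive , f-closing
    where
    L = u ∷ rest
    n≡|L| : n ≡ length L
    n≡|L| = ≤-antisym
      (≤-trans (≤-reflexive (sym (length-tabulate (λ i → i))))
               (unique-length-≤ (Unique.allFin⁺ n) (All.tabulate (λ {x} _ → covers x))))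
      (≤-trans (unique-length-≤ uniq (All.tabulate (λ {x} _ → ∈-allFin x)))
               (≤-reflexive (length-tabulate (λ i → i))))
    f : Fin n → Fin n
    f i = lookup L (cast n≡|L| i)
    f-injective : Injective _≡_ _≡_ f
    f-injective {i} {j} e = toℕ-injective (trans (sym (toℕ-cast n≡|L| i))
      (trans (cong toℕ (lookup-injective uniq (cast n≡|L| i) (cast n≡|L| j) e)) (toℕ-cast n≡|L| j)))
    f-consecutive : ∀ i j → toℕ j ≡ suc (toℕ i) → f i ~ f j
    f-consecutive i j e = chain-consecutive chain (cast n≡|L| i) (cast n≡|L| j)
      (trans (toℕ-cast n≡|L| j) (trans e (cong suc (sym (toℕ-cast n≡|L| i)))))
    f-closing : ∀ i j → toℕ i ≡ 0 → suc (toℕ j) ≡ n → f j ~ f i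
    f-closing i j i≡0 j≡n-1 with cast n≡|L| i | toℕ-cast n≡|L| i
    ... | F.zero | _ = chain-closing chain (cast n≡|L| j)
      (trans (cong suc (toℕ-cast n≡|L| j)) (trans j≡n-1 n≡|L|))
    ... | F.suc _ | e = ⊥-elim (0≢1+n (trans (sym i≡0) (sym e)))

module ClosedClawFree {n : ℕ} (G : Graph n) (claw-free : ClawFree G) (closed : Closed G) where
  open Adjacency G

  claw-dichotomy : ∀ {x p q a} → x ~ p → x ~ q → p ≢ q → ¬ p ~ q → x ~ a → a ≢ p → a ≢ q →
    a ~ p ⊎ a ~ q
  claw-dichotomy {x} {p} {q} {a} xp xq p≢q p≁q xa a≢p a≢q with a ~? p | a ~? q
  ... | yes ap | _ = inj₁ ap
  ... | no _ | yes aq = inj₂ aq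
  ... | no a≁p | no a≁q = ⊥-elim (claw-free x p q a xp xq xa p≢q (a≢p ∘ sym) (a≢q ∘ sym)
                                   (p≁q , a≁p ∘ ~-sym , a≁q ∘ ~-sym))

  -- Closedness at x: if x has nonadjacent neighbours p, q, no neighbour r of x is adjacent
  -- to both, for then every neighbour of x reaches r inside N(x) and x would be eligible.
  no-common-in-N : ∀ {x p q r} → x ~ p → x ~ q → p ≢ q → ¬ p ~ q → x ~ r → ¬ (r ~ p × r ~ q)
  no-common-in-N {x} {p} {q} {r} xp xq p≢q p≁q xr (rp , rq) = closed x (connected , not-complete)
    where
    not-complete : ¬ CompleteOn G (Adj G x)
    not-complete complete = p≁q (complete p q xp xq p≢q)
    p⇝r : WalkIn G (Adj G x) p r
    p⇝r = step xp (~-sym rp) (here xr)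
    q⇝r : WalkIn G (Adj G x) q r
    q⇝r = step xq (~-sym rq) (here xr)
    to-r : ∀ {a} → x ~ a → WalkIn G (Adj G x) a r
    to-r {a} xa with a ≟ p | a ≟ q
    ... | yes refl | _ = p⇝r
    ... | no _ | yes refl = q⇝r
    ... | no a≢p | no a≢q with claw-dichotomy xp xq p≢q p≁q xa a≢p a≢q
    ...   | inj₁ ap = step xa ap p⇝r
    ...   | inj₂ aq = step xa aq q⇝r
    connected : ConnectedOn G (Adj G x)
    connected a b xa xb = walk-++ (to-r xa) (walk-reverse (to-r xb))

  -- If x has nonadjacent neighbours wa, wb, then N(x) ∩ N(wa) is a clique: two nonadjacent
  -- vertices in it would form a claw at x together with wb.
  common-clique : ∀ {x wa wb} → x ~ wa → x ~ wb → wa ≢ wb → ¬ wa ~ wb →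
    ∀ {p q} → x ~ p × wa ~ p → x ~ q × wa ~ q → p ≢ q → p ~ q
  common-clique {x} {wa} {wb} xwa xwb wa≢wb wa≁wb {p} {q} (xp , wap) (xq , waq) p≢q with p ~? q
  ... | yes pq = pq
  ... | no p≁q = ⊥-elim (claw-free x p q wb xp xq xwb p≢q (~-≁-≢ wap wa≁wb) (~-≁-≢ waq wa≁wb)
                          (p≁q , unjoined xp wap , unjoined xq waq))
    where
    unjoined : ∀ {y} → x ~ y → wa ~ y → ¬ y ~ wb
    unjoined xy way ywb = no-common-in-N xwa xwb wa≢wb wa≁wb xy (~-sym way , ywb)

  clique-leg : ∀ {x wa wb s t} → x ~ wa → x ~ wb → wa ≢ wb → ¬ wa ~ wb →
    (∀ {y} → x ~ y × wa ~ y → s ~ y) → (∀ {y} → x ~ y × wa ~ y → y ~ t) → s ~ t →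
    Chain _~_ s (common x wa) t
  clique-leg {x} {wa} xwa xwb wa≢wb wa≁wb enter leave st =
    clique-chain (λ y → x ~ y × wa ~ y) (common x wa) (common-unique x wa) common-all
      (common-clique xwa xwb wa≢wb wa≁wb) (All.map enter common-all) leave st

module DegreeSumPair {n : ℕ} (G : Graph n) (claw-free : ClawFree G) (closed : Closed G)
  {u v : Fin n} (u≢v : u ≢ v) (u≁v : ¬ Adj G u v) (degree-sum : n ≤ deg G u + deg G v) where
  open Graph G using (adj)
  open Adjacency G
  open ClosedClawFree G claw-free closed

  common-independent : ∀ {a b} → u ~ a × v ~ a → u ~ b × v ~ b → ¬ a ~ b
  common-independent (ua , va) (ub , vb) ab =
    no-common-in-N (~-sym ua) (~-sym va) u≢v u≁v ab (~-sym ub , ~-sym vb)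

  no-three-common : ∀ {a b c} → u ~ a × v ~ a → u ~ b × v ~ b → u ~ c × v ~ c →
    a ≢ b → a ≢ c → b ≢ c → ⊥
  no-three-common ca cb cc a≢b a≢c b≢c =
    claw-free u _ _ _ (proj₁ ca) (proj₁ cb) (proj₁ cc) a≢b a≢c b≢c
      (common-independent ca cb , common-independent ca cc , common-independent cb cc)

  neither : List (Fin n)
  neither = select (λ w → not (adj u w ∨ adj v w)) (allFin n)

  neither⁺ : ∀ {x} → ¬ u ~ x → ¬ v ~ x → x ∈ neither
  neither⁺ {x} ux vx = ∈-filter⁺ (λ w → T? (not (adj u w ∨ adj v w))) (∈-allFin x)
                                 (none (≁⇒false ux) (≁⇒false vx))
    where
    none : ∀ {p q} → p ≡ false → q ≡ false → T (not (p ∨ q))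
    none refl refl = _

  -- Inclusion–exclusion turns the degree condition into |neither| ≤ |common u v|.
  neither-≤-common : length neither ≤ length (common u v)
  neither-≤-common = +-cancelˡ-≤ n (length neither) (length (common u v)) (begin
    n + length neither                           ≤⟨ +-monoˡ-≤ (length neither) degree-sum ⟩
    deg G u + deg G v + length neither           ≡⟨ inclusion-exclusion (adj u) (adj v) (allFin n) ⟩
    length (allFin n) + length (common u v)      ≡⟨ cong (_+ length (common u v)) (length-tabulate (λ i → i)) ⟩
    n + length (common u v)                      ∎)
    where open ≤-Reasoning

  u∈neither : u ∈ neither
  u∈neither = neither⁺ ~-irrefl (u≁v ∘ ~-sym)

  v∈neither : v ∈ neither
  v∈neither = neither⁺ u≁v ~-irrefl

  three-≤-common : ∀ {x} → x ≢ u → x ≢ v → ¬ u ~ x → ¬ v ~ x → 3 ≤ length (common u v)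
  three-≤-common {x} x≢u x≢v ux vx =
    ≤-trans (unique-length-≤ {xs = u ∷ v ∷ x ∷ []} distinct
              (u∈neither ∷ v∈neither ∷ neither⁺ ux vx ∷ [])) neither-≤-common
    where
    distinct : Unique (u ∷ v ∷ x ∷ [])
    distinct = (u≢v ∷ (x≢u ∘ sym) ∷ []) ∷ ((x≢v ∘ sym) ∷ []) ∷ [] ∷ []

  dominating : ∀ x → x ≢ u → x ≢ v → u ~ x ⊎ v ~ x
  dominating x x≢u x≢v with u ~? x | v ~? x
  ... | yes ux | _ = inj₁ ux
  ... | no _ | yes vx = inj₂ vx
  ... | no ux | no vx
    with three-distinct (common u v) (common-unique u v) (three-≤-common x≢u x≢v ux vx)
  ...   | _ , _ , _ , a , b , c , a≢b , a≢c , b≢c =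
          ⊥-elim (no-three-common (common⁻ a) (common⁻ b) (common⁻ c) a≢b a≢c b≢c)

  -- u and v have two distinct common neighbours, since u, v ∈ neither.
  two-common : ∃[ w₁ ] ∃[ w₂ ] ((u ~ w₁ × v ~ w₁) × (u ~ w₂ × v ~ w₂) × w₁ ≢ w₂)
  two-common with two-distinct (common u v) (common-unique u v)
    (≤-trans (unique-length-≤ {xs = u ∷ v ∷ []} ((u≢v ∷ []) ∷ [] ∷ [])
               (u∈neither ∷ v∈neither ∷ [])) neither-≤-common)
  ... | w₁ , w₂ , m₁ , m₂ , w₁≢w₂ = w₁ , w₂ , common⁻ m₁ , common⁻ m₂ , w₁≢w₂

  only-two-common : ∀ {w₁ w₂} → u ~ w₁ × v ~ w₁ → u ~ w₂ × v ~ w₂ → w₁ ≢ w₂ →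
    ∀ {x} → u ~ x → v ~ x → x ≡ w₁ ⊎ x ≡ w₂
  only-two-common {w₁} {w₂} c₁ c₂ w₁≢w₂ {x} ux vx with x ≟ w₁ | x ≟ w₂
  ... | yes e | _ = inj₁ e
  ... | no _ | yes e = inj₂ e
  ... | no x≢w₁ | no x≢w₂ = ⊥-elim (no-three-common (ux , vx) c₁ c₂ x≢w₁ x≢w₂ w₁≢w₂)

module HamiltonianCycle {n : ℕ} (G : Graph n) (claw-free : ClawFree G) (closed : Closed G)
  {u v w₁ w₂ : Fin n} (u≢v : u ≢ v) (u≁v : ¬ Adj G u v)
  (u~w₁ : Adj G u w₁) (v~w₁ : Adj G v w₁) (u~w₂ : Adj G u w₂) (v~w₂ : Adj G v w₂)
  (w₁≢w₂ : w₁ ≢ w₂) (w₁≁w₂ : ¬ Adj G w₁ w₂)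
  (only-common : ∀ {x} → Adj G u x → Adj G v x → x ≡ w₁ ⊎ x ≡ w₂)
  (dominating : ∀ x → x ≢ u → x ≢ v → Adj G u x ⊎ Adj G v x) where
  open Graph G using (adj; irrefl)
  open Adjacency G
  open ClosedClawFree G claw-free closed

  w₂≢w₁ : w₂ ≢ w₁
  w₂≢w₁ = w₁≢w₂ ∘ sym

  w₂≁w₁ : ¬ w₂ ~ w₁
  w₂≁w₁ = w₁≁w₂ ∘ ~-sym

  cycle-tail : List (Fin n)
  cycle-tail = common u w₁ ++ w₁ ∷ common v w₁ ++ v ∷ common v w₂ ++ w₂ ∷ common u w₂

  -- Consecutive entries are adjacent: each block N(x)∩N(wᵢ) is a clique entered and left
  -- through its two defining vertices.
  cycle-chain : Chain _~_ u cycle-tail u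
  cycle-chain =
    chain-++ (clique-leg u~w₁ u~w₂ w₁≢w₂ w₁≁w₂ proj₁ (~-sym ∘ proj₂) u~w₁)
    (chain-++ (clique-leg v~w₁ v~w₂ w₁≢w₂ w₁≁w₂ proj₂ (~-sym ∘ proj₁) (~-sym v~w₁))
    (chain-++ (clique-leg v~w₂ v~w₁ w₂≢w₁ w₂≁w₁ proj₁ (~-sym ∘ proj₂) v~w₂)
              (clique-leg u~w₂ u~w₁ w₂≢w₁ w₂≁w₁ proj₂ (~-sym ∘ proj₁) (~-sym u~w₂))))

  skip : ∀ {x} (xs : List (Fin n)) y {ys} → x ∈ ys → x ∈ xs ++ y ∷ ys
  skip xs y m = ∈-++⁺ʳ xs (there m)

  at : ∀ {x} (xs : List (Fin n)) {ys} → x ∈ xs ++ x ∷ ys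
  at xs = ∈-++⁺ʳ xs (here refl)

  in-w₁ : w₁ ∈ u ∷ cycle-tail
  in-w₁ = there (at (common u w₁))

  in-v : v ∈ u ∷ cycle-tail
  in-v = there (skip (common u w₁) w₁ (at (common v w₁)))

  in-w₂ : w₂ ∈ u ∷ cycle-tail
  in-w₂ = there (skip (common u w₁) w₁ (skip (common v w₁) v (at (common v w₂))))

  in-uw₁ : ∀ {x} → x ∈ common u w₁ → x ∈ u ∷ cycle-tail
  in-uw₁ m = there (∈-++⁺ˡ m)

  in-vw₁ : ∀ {x} → x ∈ common v w₁ → x ∈ u ∷ cycle-tail
  in-vw₁ m = there (skip (common u w₁) w₁ (∈-++⁺ˡ m))

  in-vw₂ : ∀ {x} → x ∈ common v w₂ → x ∈ u ∷ cycle-tail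
  in-vw₂ m = there (skip (common u w₁) w₁ (skip (common v w₁) v (∈-++⁺ˡ m)))

  in-uw₂ : ∀ {x} → x ∈ common u w₂ → x ∈ u ∷ cycle-tail
  in-uw₂ m = there (skip (common u w₁) w₁ (skip (common v w₁) v (skip (common v w₂) w₂ m)))

  -- Every vertex occurs: a vertex outside {u, w₁, v, w₂} is adjacent to u or v, and then
  -- (claw-freeness at u resp. v) to w₁ or w₂.
  cycle-covers : ∀ x → x ∈ u ∷ cycle-tail
  cycle-covers x with x ≟ u | x ≟ w₁ | x ≟ v | x ≟ w₂
  ... | yes refl | _ | _ | _ = here refl
  ... | no _ | yes refl | _ | _ = in-w₁
  ... | no _ | no _ | yes refl | _ = in-v
  ... | no _ | no _ | no _ | yes refl = in-w₂
  ... | no x≢u | no x≢w₁ | no x≢v | no x≢w₂ with dominating x x≢u x≢v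
  ...   | inj₁ ux with claw-dichotomy u~w₁ u~w₂ w₁≢w₂ w₁≁w₂ ux x≢w₁ x≢w₂
  ...     | inj₁ xw₁ = in-uw₁ (common⁺ ux (~-sym xw₁))
  ...     | inj₂ xw₂ = in-uw₂ (common⁺ ux (~-sym xw₂))
  cycle-covers x | no x≢u | no x≢w₁ | no x≢v | no x≢w₂ | inj₂ vx
    with claw-dichotomy v~w₁ v~w₂ w₁≢w₂ w₁≁w₂ vx x≢w₁ x≢w₂
  ...     | inj₁ xw₁ = in-vw₁ (common⁺ vx (~-sym xw₁))
  ...     | inj₂ xw₂ = in-vw₂ (common⁺ vx (~-sym xw₂))

  common-isolated : ∀ {x} → u ~ x → v ~ x → ¬ w₁ ~ x × ¬ w₂ ~ x
  common-isolated ux vx with only-common ux vx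
  ... | inj₁ refl = ~-irrefl , w₂≁w₁
  ... | inj₂ refl = w₁≁w₂ , ~-irrefl

  not-both-w : ∀ {z x} → z ~ w₁ → z ~ w₂ → z ~ x → w₂ ~ x → ¬ w₁ ~ x
  not-both-w zw₁ zw₂ zx w₂x w₁x = no-common-in-N zw₁ zw₂ w₁≢w₂ w₁≁w₂ zx (~-sym w₁x , ~-sym w₂x)

  -- The rank of a vertex: the index of the first of the eight blocks of the cycle
  -- containing it.
  rank : Fin n → ℕ
  rank x =
    if does (x ≟ u) then 0 else if adj u x ∧ adj w₁ x then 1 else
    if does (x ≟ w₁) then 2 else if adj v x ∧ adj w₁ x then 3 else
    if does (x ≟ v) then 4 else if adj v x ∧ adj w₂ x then 5 else
    if does (x ≟ w₂) then 6 else 7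

  -- Each block has its rank: its vertices fail the membership tests of all earlier blocks.
  rank-u : rank u ≡ 0
  rank-u rewrite dec-true (u ≟ u) refl = refl

  rank-uw₁ : ∀ {x} → u ~ x × w₁ ~ x → rank x ≡ 1
  rank-uw₁ {x} (ux , w₁x) rewrite dec-false (x ≟ u) (~⇒≢˘ ux) | ux | w₁x = refl

  rank-w₁ : rank w₁ ≡ 2
  rank-w₁ rewrite dec-false (w₁ ≟ u) (~⇒≢˘ u~w₁) | u~w₁ | irrefl w₁ | dec-true (w₁ ≟ w₁) refl = refl

  rank-vw₁ : ∀ {x} → v ~ x × w₁ ~ x → rank x ≡ 3
  rank-vw₁ {x} (vx , w₁x)
    rewrite dec-false (x ≟ u) (~-≁-≢ vx (u≁v ∘ ~-sym)) | ≁⇒false (λ ux → proj₁ (common-isolated ux vx) w₁x)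
          | dec-false (x ≟ w₁) (~⇒≢˘ w₁x) | vx | w₁x = refl

  rank-v : rank v ≡ 4
  rank-v rewrite dec-false (v ≟ u) (u≢v ∘ sym) | ≁⇒false u≁v | dec-false (v ≟ w₁) (~⇒≢ v~w₁)
               | irrefl v | dec-true (v ≟ v) refl = refl

  rank-vw₂ : ∀ {x} → v ~ x × w₂ ~ x → rank x ≡ 5
  rank-vw₂ {x} (vx , w₂x)
    rewrite dec-false (x ≟ u) (~-≁-≢ vx (u≁v ∘ ~-sym)) | ≁⇒false (λ ux → proj₂ (common-isolated ux vx) w₂x)
          | dec-false (x ≟ w₁) (~-≁-≢ w₂x w₂≁w₁) | vx | ≁⇒false (not-both-w v~w₁ v~w₂ vx w₂x)
          | dec-false (x ≟ v) (~⇒≢˘ vx) | w₂x = refl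

  rank-w₂ : rank w₂ ≡ 6
  rank-w₂ rewrite dec-false (w₂ ≟ u) (~⇒≢˘ u~w₂) | u~w₂ | ≁⇒false w₁≁w₂ | dec-false (w₂ ≟ w₁) w₂≢w₁
                | v~w₂ | dec-false (w₂ ≟ v) (~⇒≢˘ v~w₂) | irrefl w₂ | dec-true (w₂ ≟ w₂) refl = refl

  rank-uw₂ : ∀ {x} → u ~ x × w₂ ~ x → rank x ≡ 7
  rank-uw₂ {x} (ux , w₂x)
    rewrite dec-false (x ≟ u) (~⇒≢˘ ux) | ux | ≁⇒false (not-both-w u~w₁ u~w₂ ux w₂x)
          | dec-false (x ≟ w₁) (~-≁-≢ w₂x w₂≁w₁) | ≁⇒false (λ vx → proj₂ (common-isolated ux vx) w₂x)
          | dec-false (x ≟ v) (~-≁-≢ ux u≁v) | dec-false (x ≟ w₂) (~⇒≢˘ w₂x) = refl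

  -- No vertex repeats, since the ranks 0, …, 7 of the blocks increase along the cycle.
  cycle-unique : Unique (u ∷ cycle-tail)
  cycle-unique = proj₁
    (vertex rank-u (block rank-uw₁ (vertex rank-w₁ (block rank-vw₁
    (vertex rank-v (block rank-vw₂ (vertex rank-w₂ last-block)))))))
    where
    vertex : ∀ {x k r} → rank x ≡ k → RankedFrom rank (suc k) r → RankedFrom rank k (x ∷ r)
    vertex e = prepend-block rank ([] ∷ []) (e ∷ [])
    block : ∀ {a b k r} → (∀ {x} → a ~ x × b ~ x → rank x ≡ k) → RankedFrom rank (suc k) r →
      RankedFrom rank k (common a b ++ r)
    block {a} {b} ranked = prepend-block rank (common-unique a b) (All.map ranked common-all)
    last-block : RankedFrom rank 7 (common u w₂)
    last-block = common-unique u w₂ , All.map (≤-reflexive ∘ sym ∘ rank-uw₂) common-all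

  hamiltonian : 3 ≤ n → Hamiltonian G
  hamiltonian n≥3 = cycle⇒hamiltonian n≥3 u cycle-tail cycle-unique cycle-covers cycle-chain

lemma1 : ∀ (n : ℕ) (G : Graph n) → TwoConnected G → ClawFree G → Closed G →
    (∃[ u ] ∃[ v ] (u ≢ v × ¬ Adj G u v × n ≤ deg G u + deg G v)) →
    Hamiltonian G
lemma1 n G (n≥3 , _) claw-free closed (u , v , u≢v , u≁v , degree-sum)
  with DegreeSumPair.two-common G claw-free closed u≢v u≁v degree-sum
... | w₁ , w₂ , c₁ , c₂ , w₁≢w₂ =
  HamiltonianCycle.hamiltonian G claw-free closed u≢v u≁v (proj₁ c₁) (proj₂ c₁) (proj₁ c₂) (proj₂ c₂)
    w₁≢w₂ (common-independent c₁ c₂) (only-two-common c₁ c₂ w₁≢w₂) dominating n≥3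
  where open DegreeSumPair G claw-free closed u≢v u≁v degree-sum
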